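{- Let $0\leq i\leq j$ be integers and $G$ an $(i,j)$-critical multigraph. Let $v$ be a vertex of $G$ with exactly one neighbor $u$, and let $(L,\mathcal H)$ be a 2-fold cover of $G$ that has no $(i,j)$-coloring. Then $\mathcal H[L(v),L(u)]$ contains both the even matching $\{r(v)r(u),p(v)p(u)\}$ and the odd matching $\{r(v)p(u),p(v)r(u)\}$. In particular, $G$ has minimum degree at least $2$, and for each flag vertex $v$ with neighbor $u$, one matching in $\mathcal H[L(v),L(u)]$ is even and one is odd.
   Context: Multigraphs are finite without loops. A 2-fold cover of a multigraph $G$ is a pair $(L,\mathcal H)$ where $\mathcal H$ is a graph and $L$ assigns to each $v\in V(G)$ a 2-element set $L(v)=\{p(v),r(v)\}$ ($p(v)$ poor, $r(v)$ rich) such that the sets $L(v)$ partition $V(\mathcal H)$, $p(v)r(v)\in E(\mathcal H)$, edges of $\mathcal H$ between $L(u)$ and $L(v)$ ($u\ne v$) exist only if $uv\in E(G)$, and if $u,v$ are joined by $k\ge1$ edges then $\mathcal H[L(u),L(v)]$ is a union of at most $k$ perfect matchings between $L(u)$ and $L(v)$. An $\mathcal H$-map is a function $\phi$ with $\phi(v)\in L(v)$; $\mathcal H_\phi$ is the subgraph induced by $\phi(V(G))$. An $(i,j)$-coloring is an $\mathcal H$-map $\phi$ in which poor vertices of $\mathcal H_\phi$ have degree at most $i$ and rich ones degree at most $j$ in $\mathcal H_\phi$. $G$ is $(i,j)$-critical if some 2-fold cover of $G$ has no $(i,j)$-coloring while every 2-fold cover of each proper subgraph has one. A flag at a vertex $w$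 is a vertex $u$ joined to $w$ by exactly two parallel edges and incident with no other edges; $u$ is called a flag vertex. -}

module Defs where

open import Data.Nat using (ℕ; _≤_; _<_; _+_)
open import Data.Fin using (Fin)
open import Data.Bool using (Bool; true; false; if_then_else_)
open import Data.List using (List; length; map; allFin)
open import Data.Nat.ListAction using (sum)
open import Data.List.Membership.Propositional using (_∈_)
open import Data.Product using (Σ; ∃; ∃-syntax; _×_; _,_)
open import Relation.Binary.PropositionalEquality using (_≡_; _≢_)
open import Relation.Nullary using (¬_)
open import Function.Definitions using (Injective; Surjective)

record Multigraph : Set where
  field
    n        : ℕ
    mult     : Fin n → Fin n → ℕ
    sym      : ∀ u v → mult u v ≡ mult v u
    loopless : ∀ v → mult v v ≡ 0
open Multigraph public

-- The two vertices of L(v): p(v) (poor) and r(v) (rich).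
data Side : Set where
  poor rich : Side

Adjacent : (G : Multigraph) → Fin (n G) → Fin (n G) → Set
Adjacent G u v = 1 ≤ mult G u v

degG : (G : Multigraph) → Fin (n G) → ℕ
degG G v = sum (map (mult G v) (allFin (n G)))

-- A perfect matching between L(u) and L(v) (two-element sets) is a bijection
-- Side → Side (sending a ∈ L(u) to its partner in L(v)); on a finite set of the
-- same size, injectivity is bijectivity.
record PerfectMatching : Set where
  field
    σ   : Side → Side
    inj : ∀ a b → σ a ≡ σ b → a ≡ b
open PerfectMatching public

-- V(𝓗) = Fin n × Side, with L(v) = {(v,poor),(v,rich)}.
-- 𝓗 is a simple graph given by a decidable (Bool-valued) symmetric irreflexive
-- adjacency.  For u ≠ v, 𝓗[L(u),L(v)] is the union of the (at most mult u v)
-- perfect matchings listed in `matchings u v`.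
record Cover (G : Multigraph) : Set where
  field
    adj          : Fin (n G) × Side → Fin (n G) × Side → Bool
    adj-sym      : ∀ x y → adj x y ≡ adj y x
    adj-irrefl   : ∀ x → adj x x ≡ false
    poor-rich    : ∀ v → adj (v , poor) (v , rich) ≡ true
    edges-in-G   : ∀ u v a b → u ≢ v → adj (u , a) (v , b) ≡ true → Adjacent G u v
    matchings    : Fin (n G) → Fin (n G) → List PerfectMatching
    matchings-≤  : ∀ u v → u ≢ v → length (matchings u v) ≤ mult G u v
    matchings-⇒  : ∀ u v a b → u ≢ v → adj (u , a) (v , b) ≡ true →
                   ∃[ M ] (M ∈ matchings u v × σ M a ≡ b)
    matchings-⇐  : ∀ u v a b → u ≢ v → (M : PerfectMatching) → M ∈ matchings u v →
                   σ M a ≡ b → adj (u , a) (v , b) ≡ true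
open Cover public

HMap : Multigraph → Set
HMap G = Fin (n G) → Side

-- degree of φ(v) in 𝓗_φ (adjacency is irreflexive, so w = v contributes 0)
degφ : {G : Multigraph} → Cover G → HMap G → Fin (n G) → ℕ
degφ {G} C φ v =
  sum (map (λ w → if adj C (v , φ v) (w , φ w) then 1 else 0) (allFin (n G)))

bound : ℕ → ℕ → Side → ℕ
bound i j poor = i
bound i j rich = j

IsColoring : (i j : ℕ) {G : Multigraph} → Cover G → HMap G → Set
IsColoring i j {G} C φ = ∀ v → degφ C φ v ≤ bound i j (φ v)

Colorable : (i j : ℕ) {G : Multigraph} → Cover G → Set
Colorable i j {G} C = Σ (HMap G) (IsColoring i j C)

record Subgraph (G' G : Multigraph) : Set where
  field
    f      : Fin (n G') → Fin (n G)
    f-inj  : Injective _≡_ _≡_ f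
    mult-≤ : ∀ x y → mult G' x y ≤ mult G (f x) (f y)
open Subgraph public

Proper : {G' G : Multigraph} → Subgraph G' G → Set
Proper {G'} {G} S =
  ¬ (Surjective _≡_ _≡_ (f S) × (∀ x y → mult G' x y ≡ mult G (f S x) (f S y)))

Critical : (i j : ℕ) → Multigraph → Set
Critical i j G =
  (Σ (Cover G) λ C → ¬ Colorable i j C) ×
  (∀ (G' : Multigraph) (S : Subgraph G' G) → Proper S → (C : Cover G') → Colorable i j C)

UniqueNeighbour : (G : Multigraph) → Fin (n G) → Fin (n G) → Set
UniqueNeighbour G v u = Adjacent G v u × (∀ w → Adjacent G v w → w ≡ u)

FlagAt : (G : Multigraph) → Fin (n G) → Fin (n G) → Set
FlagAt G v u = mult G v u ≡ 2 × (∀ w → w ≢ u → mult G v w ≡ 0)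

IsEven IsOdd : PerfectMatching → Set
IsEven M = ∀ a → σ M a ≡ a
IsOdd M = ∀ a → σ M a ≢ a

module Submission where

-- Call a cover C of G "safe at v" if, whatever sides the other
-- vertices choose, some side of v is adjacent in 𝓗 to none of the chosen
-- vertices.  If all proper subgraphs of G are colorable, a cover safe at v is
-- colorable: color G − v, then give v the safe side; v gets degree 0 and no
-- other degree changes (section Deletion, lemma safe⇒colorable).
--
-- Let v have unique neighbour u.  The edges of 𝓗[L(v),L(u)] form a union of
-- perfect matchings of two-element sets, hence are invariant under swapping
-- poor and rich at both ends (edge-flip).  So if r(v)r(u) (resp. r(v)p(u))
-- were missing, the whole even (resp. odd) matching would be missing, and the
-- cover would be safe at v; an uncolorable cover therefore contains both
-- (module Leaf).  Consequences: the even and odd matchings are distinct, so a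
-- leaf is joined to its neighbour by at least two edges; an isolated vertex is
-- trivially safe; hence every vertex has degree at least two (MinimumDegree).
-- A flag vertex is a leaf, and the matchings through r(v) are even and odd.

open import Defs
open import Data.Nat as ℕ using (ℕ; suc; _≤_; _+_; z≤n; s≤s)
open import Data.Nat.Properties
  using (+-0-commutativeMonoid; m≤m+n; m≤n+m; ≤-refl; ≤-trans; +-monoʳ-≤; +-mono-≤; n≢0⇒n>0)
  renaming (_≟_ to _≟ℕ_; _≤?_ to _≤?ℕ_)
open import Data.Fin using (Fin; zero; suc; punchIn; _≟_)
open import Data.Fin.Properties using (punchIn-injective; punchInᵢ≢i; punchIn-punchOut; all?; ¬∀⟶∃¬)
open import Data.Bool as Bool using (Bool; true; false; if_then_else_)
open import Data.Bool.Properties using (¬-not)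
open import Data.List using (List; []; _∷_; length; map; allFin; tabulate)
open import Data.List.Properties using (map-tabulate)
open import Data.List.Membership.Propositional using (_∈_)
open import Data.List.Relation.Unary.Any using (here)
open import Data.Nat.ListAction using (sum)
open import Data.Product using (∃-syntax; _×_; _,_; proj₁; proj₂)
open import Data.Sum using (_⊎_; inj₁; inj₂)
open import Data.Vec.Functional using (insertAt)
open import Data.Vec.Functional.Properties using (insertAt-lookup; insertAt-punchIn)
open import Relation.Binary.PropositionalEquality
  using (_≡_; _≢_; refl; cong; cong₂; subst; subst₂; module ≡-Reasoning)
  renaming (sym to ≡-sym; trans to ≡-trans)
open import Relation.Nullary using (¬_; yes; no; contradiction)
open import Relation.Nullary.Decidable using (decidable-stable)
open import Function using (_∘_; id)
import Algebra.Properties.CommutativeMonoid.Sum +-0-commutativeMonoid as ∑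

sum-allFin : ∀ {k} (g : Fin k → ℕ) → sum (map g (allFin k)) ≡ ∑.sum g
sum-allFin g = ≡-trans (cong sum (map-tabulate id g)) (sum-tabulate g)
  where
  sum-tabulate : ∀ {k} (h : Fin k → ℕ) → sum (tabulate h) ≡ ∑.sum h
  sum-tabulate {ℕ.zero} h = refl
  sum-tabulate {suc k}  h = cong (h zero +_) (sum-tabulate (h ∘ suc))

term≤∑ : ∀ {k} (g : Fin k → ℕ) (x : Fin k) → g x ≤ ∑.sum g
term≤∑ g zero    = m≤m+n _ _
term≤∑ g (suc x) = ≤-trans (term≤∑ (g ∘ suc) x) (m≤n+m _ (g zero))

twoTerms≤∑ : ∀ {k} (g : Fin k → ℕ) {x y : Fin k} → x ≢ y → g x + g y ≤ ∑.sum g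
twoTerms≤∑ {k = suc _} g {x} {y} x≢y =
  subst (g x + g y ≤_) (≡-sym (∑.sum-remove {i = x} g))
    (+-monoʳ-≤ (g x) (subst (_≤ ∑.sum (g ∘ punchIn x)) (cong g (punchIn-punchOut x≢y))
                             (term≤∑ (g ∘ punchIn x) _)))

data Punctured {m : ℕ} (v : Fin (suc m)) : Fin (suc m) → Set where
  centre : Punctured v v
  other  : ∀ y → Punctured v (punchIn v y)

punctured : ∀ {m} (v x : Fin (suc m)) → Punctured v x
punctured v x with v ≟ x
... | yes refl = centre
... | no v≢x   = subst (Punctured v) (punchIn-punchOut v≢x) (other _)

ProperSubgraphsColorable : ℕ → ℕ → Multigraph → Set
ProperSubgraphsColorable i j G =
  ∀ (G' : Multigraph) (S : Subgraph G' G) → Proper S → (C : Cover G') → Colorable i j C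

SafeAt : (G : Multigraph) → Cover G → Fin (n G) → Set
SafeAt G C v = ∀ (φ : HMap G) → ∃[ s ] (∀ w → w ≢ v → adj C (v , s) (w , φ w) ≡ false)

-- Deleting a vertex v from a multigraph on Fin (suc m); the vertex y of
-- G − v is the vertex punchIn v y of G.
module Deletion {m : ℕ} (μ : Fin (suc m) → Fin (suc m) → ℕ)
                (μ-sym : ∀ x y → μ x y ≡ μ y x) (μ-loopless : ∀ x → μ x x ≡ 0)
                (v : Fin (suc m)) where

  G : Multigraph
  G = record { n = suc m ; mult = μ ; sym = μ-sym ; loopless = μ-loopless }

  G−v : Multigraph
  G−v = record
    { n        = m
    ; mult     = λ x y → μ (punchIn v x) (punchIn v y)
    ; sym      = λ x y → μ-sym (punchIn v x) (punchIn v y)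
    ; loopless = λ x → μ-loopless (punchIn v x)
    }

  inclusion : Subgraph G−v G
  inclusion = record
    { f      = punchIn v
    ; f-inj  = punchIn-injective v _ _
    ; mult-≤ = λ _ _ → ≤-refl
    }

  -- v itself is not in the image, so G − v is a proper subgraph.
  inclusion-proper : Proper inclusion
  inclusion-proper (onto , _) with onto v
  ... | y , hit = punchInᵢ≢i v y (hit refl)

  punchIn-≢ : ∀ {x y} → x ≢ y → punchIn v x ≢ punchIn v y
  punchIn-≢ x≢y = x≢y ∘ punchIn-injective v _ _

  restrict : Cover G → Cover G−v
  restrict C = record
    { adj         = λ (x , a) (y , b) → adj C (punchIn v x , a) (punchIn v y , b)
    ; adj-sym     = λ _ _ → adj-sym C _ _
    ; adj-irrefl  = λ _ → adj-irrefl C _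
    ; poor-rich   = λ x → poor-rich C (punchIn v x)
    ; edges-in-G  = λ x y a b x≢y → edges-in-G C _ _ a b (punchIn-≢ x≢y)
    ; matchings   = λ x y → matchings C (punchIn v x) (punchIn v y)
    ; matchings-≤ = λ x y x≢y → matchings-≤ C _ _ (punchIn-≢ x≢y)
    ; matchings-⇒ = λ x y a b x≢y → matchings-⇒ C _ _ a b (punchIn-≢ x≢y)
    ; matchings-⇐ = λ x y a b x≢y → matchings-⇐ C _ _ a b (punchIn-≢ x≢y)
    }

  -- Extending a coloring ψ of G − v by a side s of v that sees none of the
  -- chosen vertices: v gets degree 0 and no other degree changes.
  module Extension (C : Cover G) (ψ : HMap G−v) (s : Side)
                   (unseen : ∀ y → adj C (v , s) (punchIn v y , ψ y) ≡ false) where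

    φ : HMap G
    φ = insertAt ψ v s

    φ-other : ∀ y → φ (punchIn v y) ≡ ψ y
    φ-other = insertAt-punchIn ψ v s

    edge : Bool → ℕ
    edge b = if b then 1 else 0

    v-isolated : ∀ y → adj C (v , φ v) (punchIn v y , φ (punchIn v y)) ≡ false
    v-isolated y = subst (λ (a , b) → adj C (v , a) (punchIn v y , b) ≡ false)
                         (cong₂ _,_ (≡-sym (insertAt-lookup ψ v s)) (≡-sym (φ-other y)))
                         (unseen y)

    degree-centre : degφ C φ v ≡ 0
    degree-centre = begin
      degφ C φ v               ≡⟨ sum-allFin row ⟩
      ∑.sum row                ≡⟨ ∑.sum-cong-≗ no-edge ⟩
      ∑.sum {suc m} (λ _ → 0)  ≡⟨ ∑.sum-replicate-zero (suc m) ⟩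
      0                        ∎
      where
      open ≡-Reasoning
      row : Fin (suc m) → ℕ
      row w = edge (adj C (v , φ v) (w , φ w))
      no-edge : ∀ w → row w ≡ 0
      no-edge w with punctured v w
      ... | centre  = cong edge (adj-irrefl C (v , φ v))
      ... | other y = cong edge (v-isolated y)

    degree-other : ∀ y → degφ C φ (punchIn v y) ≡ degφ (restrict C) ψ y
    degree-other y = begin
      degφ C φ x                       ≡⟨ sum-allFin row ⟩
      ∑.sum row                        ≡⟨ ∑.sum-remove {i = v} row ⟩
      row v + ∑.sum (row ∘ punchIn v)  ≡⟨ cong₂ _+_ row-v (∑.sum-cong-≗ row-rest) ⟩
      ∑.sum row′                       ≡⟨ ≡-sym (sum-allFin row′) ⟩
      degφ (restrict C) ψ y            ∎
      where
      open ≡-Reasoning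
      x : Fin (suc m)
      x = punchIn v y
      row : Fin (suc m) → ℕ
      row w = edge (adj C (x , φ x) (w , φ w))
      row′ : Fin m → ℕ
      row′ w = edge (adj C (x , ψ y) (punchIn v w , ψ w))
      row-v : row v ≡ 0
      row-v = cong edge (≡-trans (adj-sym C _ _) (v-isolated y))
      row-rest : ∀ w → row (punchIn v w) ≡ row′ w
      row-rest w = cong₂ (λ a b → edge (adj C (x , a) (punchIn v w , b))) (φ-other y) (φ-other w)

    extend : ∀ {i j} → IsColoring i j (restrict C) ψ → IsColoring i j C φ
    extend {i} {j} col x with punctured v x
    ... | centre  = subst (_≤ bound i j (φ v)) (≡-sym degree-centre) z≤n
    ... | other y = subst₂ _≤_ (≡-sym (degree-other y)) (cong (bound i j) (≡-sym (φ-other y))) (col y)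

  -- Color G − v, then let the safe choice at v pick the side of v.
  safe⇒colorable : ∀ {i j} → ProperSubgraphsColorable i j G →
                   (C : Cover G) → SafeAt G C v → Colorable i j C
  safe⇒colorable {i} {j} crit C safe = φ , extend (proj₂ coloring)
    where
    coloring : Colorable i j (restrict C)
    coloring = crit G−v inclusion inclusion-proper (restrict C)
    ψ : HMap G−v
    ψ = proj₁ coloring
    chosen : ∃[ s ] (∀ w → w ≢ v → adj C (v , s) (w , insertAt ψ v poor w) ≡ false)
    chosen = safe (insertAt ψ v poor)
    unseen : ∀ y → adj C (v , proj₁ chosen) (punchIn v y , ψ y) ≡ false
    unseen y = subst (λ b → adj C (v , proj₁ chosen) (punchIn v y , b) ≡ false)
                     (insertAt-punchIn ψ v poor y)
                     (proj₂ chosen (punchIn v y) (punchInᵢ≢i v y))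
    open Extension C ψ (proj₁ chosen) unseen

safe⇒colorable : ∀ {i j} (G : Multigraph) → ProperSubgraphsColorable i j G →
                 (C : Cover G) (v : Fin (n G)) → SafeAt G C v → Colorable i j C
safe⇒colorable record { n = suc m ; mult = μ ; sym = μ-sym ; loopless = μ-loopless } crit C v =
  Deletion.safe⇒colorable μ μ-sym μ-loopless v crit C

flip : Side → Side
flip poor = rich
flip rich = poor

flip-≢ : ∀ a → flip a ≢ a
flip-≢ poor ()
flip-≢ rich ()

flip-involutive : ∀ a → flip (flip a) ≡ a
flip-involutive poor = refl
flip-involutive rich = refl

side-cases : ∀ b c → b ≡ c ⊎ b ≡ flip c
side-cases poor poor = inj₁ refl
side-cases poor rich = inj₂ refl
side-cases rich poor = inj₂ refl
side-cases rich rich = inj₁ refl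

-- A perfect matching between two-element sets commutes with swapping sides:
-- σ (flip a) ≠ σ a by injectivity, so it is the other side.
matching-flip : (M : PerfectMatching) (a : Side) → σ M (flip a) ≡ flip (σ M a)
matching-flip M a with side-cases (σ M (flip a)) (σ M a)
... | inj₁ same    = contradiction (inj M _ _ same) (flip-≢ a)
... | inj₂ flipped = flipped

-- Hence a matching is determined by the image of rich.
fixes-rich⇒even : (M : PerfectMatching) → σ M rich ≡ rich → IsEven M
fixes-rich⇒even M fix rich = fix
fixes-rich⇒even M fix poor = ≡-trans (matching-flip M rich) (cong flip fix)

moves-rich⇒odd : (M : PerfectMatching) → σ M rich ≡ poor → IsOdd M
moves-rich⇒odd M move rich fix = flip-≢ poor (≡-trans (≡-sym fix) move)
moves-rich⇒odd M move poor fix =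
  flip-≢ poor (≡-trans (≡-sym (≡-trans (matching-flip M rich) (cong flip move))) fix)

-- The edges of 𝓗 between L(v) and L(u) are invariant under swapping sides at
-- both ends, since they form a union of perfect matchings.
edge-flip : {G : Multigraph} (C : Cover G) {v u : Fin (n G)} → v ≢ u → ∀ {a b} →
            adj C (v , a) (u , b) ≡ true → adj C (v , flip a) (u , flip b) ≡ true
edge-flip C v≢u {a} {b} e with matchings-⇒ C _ _ a b v≢u e
... | M , M∈ , a↦b = matchings-⇐ C _ _ _ _ v≢u M M∈ (≡-trans (matching-flip M a) (cong flip a↦b))

distinct-members : ∀ {A : Set} {x y : A} (xs : List A) → x ∈ xs → y ∈ xs → x ≢ y → 2 ≤ length xs
distinct-members (_ ∷ [])    (here refl) (here refl) x≢y = contradiction refl x≢y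
distinct-members (_ ∷ _ ∷ _) _           _           _   = s≤s (s≤s z≤n)

module Leaf {i j : ℕ} (G : Multigraph) (crit : ProperSubgraphsColorable i j G)
            (C : Cover G) (uncolorable : ¬ Colorable i j C)
            {v u : Fin (n G)} (leaf : UniqueNeighbour G v u) where

  v≢u : v ≢ u
  v≢u refl = contradiction (subst (1 ≤_) (loopless G v) (proj₁ leaf)) λ ()

  -- If every side of u is missed by some side of v, C is safe at v, since u
  -- is the only vertex v can see.
  safe-if-missed : (∀ b → ∃[ s ] adj C (v , s) (u , b) ≡ false) → SafeAt G C v
  safe-if-missed miss φ = s , unseen
    where
    s : Side
    s = proj₁ (miss (φ u))
    unseen : ∀ w → w ≢ v → adj C (v , s) (w , φ w) ≡ false
    unseen w w≢v with w ≟ u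
    ... | yes refl = proj₂ (miss (φ u))
    ... | no w≢u   = ¬-not λ e → w≢u (proj₂ leaf w (edges-in-G C v w _ _ (w≢v ∘ ≡-sym) e))

  -- If r(v)c is missing, so is p(v)(flip c), and then the sides of u are
  -- missed by the matching {r(v) ↦ c, p(v) ↦ flip c}.
  missed-if-rich-missing : ∀ c → adj C (v , rich) (u , c) ≢ true →
                           ∀ b → ∃[ s ] adj C (v , s) (u , b) ≡ false
  missed-if-rich-missing c rich-missing b with side-cases b c
  ... | inj₁ refl = rich , ¬-not rich-missing
  ... | inj₂ refl = poor , ¬-not poor-missing
    where
    poor-missing : adj C (v , poor) (u , flip c) ≢ true
    poor-missing e = rich-missing (subst (λ b → adj C (v , rich) (u , b) ≡ true)
                                         (flip-involutive c) (edge-flip C v≢u e))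

  -- So r(v) is adjacent to both sides of u, else C would be colorable.
  rich-edge : ∀ c → adj C (v , rich) (u , c) ≡ true
  rich-edge c = decidable-stable (adj C (v , rich) (u , c) Bool.≟ true) λ rich-missing →
    uncolorable (safe⇒colorable G crit C v (safe-if-missed (missed-if-rich-missing c rich-missing)))

  both-matchings : (adj C (v , rich) (u , rich) ≡ true × adj C (v , poor) (u , poor) ≡ true) ×
                   (adj C (v , rich) (u , poor) ≡ true × adj C (v , poor) (u , rich) ≡ true)
  both-matchings = (rich-edge rich , edge-flip C v≢u (rich-edge rich))
                 , (rich-edge poor , edge-flip C v≢u (rich-edge poor))

  even-matching : ∃[ M ] (M ∈ matchings C v u × IsEven M)
  even-matching with matchings-⇒ C v u rich rich v≢u (rich-edge rich)
  ... | M , M∈ , fix = M , M∈ , fixes-rich⇒even M fix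

  odd-matching : ∃[ M ] (M ∈ matchings C v u × IsOdd M)
  odd-matching with matchings-⇒ C v u rich poor v≢u (rich-edge poor)
  ... | M , M∈ , move = M , M∈ , moves-rich⇒odd M move

  -- The even and odd matchings are distinct, so v and u are joined by at
  -- least two parallel edges.
  multiplicity : 2 ≤ mult G v u
  multiplicity with even-matching | odd-matching
  ... | E , E∈ , even | O , O∈ , odd =
    ≤-trans (distinct-members (matchings C v u) E∈ O∈ E≢O) (matchings-≤ C v u v≢u)
    where
    E≢O : E ≢ O
    E≢O refl = odd rich (even rich)

flag⇒leaf : {G : Multigraph} {v u : Fin (n G)} → FlagAt G v u → UniqueNeighbour G v u
flag⇒leaf {G} {v} {u} (double , elsewhere-none) = subst (1 ≤_) (≡-sym double) (s≤s z≤n) , only-u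
  where
  only-u : ∀ w → Adjacent G v w → w ≡ u
  only-u w adj-w with w ≟ u
  ... | yes w≡u = w≡u
  ... | no w≢u  = contradiction (subst (1 ≤_) (elsewhere-none w w≢u) adj-w) λ ()

mult≤deg : (G : Multigraph) (w x : Fin (n G)) → mult G w x ≤ degG G w
mult≤deg G w x = subst (mult G w x ≤_) (≡-sym (sum-allFin (mult G w))) (term≤∑ (mult G w) x)

two-neighbours : (G : Multigraph) {w x y : Fin (n G)} → x ≢ y →
                 Adjacent G w x → Adjacent G w y → 2 ≤ degG G w
two-neighbours G {w} {x} {y} x≢y adj-x adj-y =
  ≤-trans (+-mono-≤ adj-x adj-y)
    (subst (mult G w x + mult G w y ≤_) (≡-sym (sum-allFin (mult G w))) (twoTerms≤∑ (mult G w) x≢y))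

-- Minimum degree two: an isolated vertex makes the cover safe, and a vertex of
-- degree at most one with a neighbour x has x as unique neighbour, joined to
-- it by at least two edges by Leaf.multiplicity.
module MinimumDegree {i j : ℕ} (G : Multigraph) (crit : ProperSubgraphsColorable i j G)
                     (C : Cover G) (uncolorable : ¬ Colorable i j C) where

  isolated-safe : ∀ w → (∀ x → mult G w x ≡ 0) → SafeAt G C w
  isolated-safe w isolated φ = poor , λ x x≢w → ¬-not λ e →
    contradiction (subst (1 ≤_) (isolated x) (edges-in-G C w x _ _ (x≢w ∘ ≡-sym) e)) λ ()

  not-low : ∀ w → ¬ ¬ (2 ≤ degG G w)
  not-low w low with all? (λ x → mult G w x ≟ℕ 0)
  ... | yes isolated = uncolorable (safe⇒colorable G crit C w (isolated-safe w isolated))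
  ... | no ¬isolated = low (≤-trans (Leaf.multiplicity G crit C uncolorable leaf) (mult≤deg G w x))
    where
    neighbour : ∃[ x ] ¬ mult G w x ≡ 0
    neighbour = ¬∀⟶∃¬ (n G) (λ x → mult G w x ≡ 0) (λ x → mult G w x ≟ℕ 0) ¬isolated
    x : Fin (n G)
    x = proj₁ neighbour
    adj-x : Adjacent G w x
    adj-x = n≢0⇒n>0 (proj₂ neighbour)
    leaf : UniqueNeighbour G w x
    leaf = adj-x , λ y adj-y → decidable-stable (y ≟ x) λ y≢x →
      low (two-neighbours G (y≢x ∘ ≡-sym) adj-x adj-y)

  min-degree : ∀ w → 2 ≤ degG G w
  min-degree w = decidable-stable (2 ≤?ℕ degG G w) (not-low w)

lemma10p3 : (i j : ℕ) → i ≤ j → (G : Multigraph) → Critical i j G →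
    (v u : Fin (n G)) → UniqueNeighbour G v u →
    (C : Cover G) → ¬ Colorable i j C →
    ((adj C (v , rich) (u , rich) ≡ true × adj C (v , poor) (u , poor) ≡ true) ×
     (adj C (v , rich) (u , poor) ≡ true × adj C (v , poor) (u , rich) ≡ true)) ×
    (∀ (w : Fin (n G)) → 2 ≤ degG G w) ×
    (∀ (v' u' : Fin (n G)) → FlagAt G v' u' →
      (∃[ M ] (M ∈ matchings C v' u' × IsEven M)) × (∃[ M ] (M ∈ matchings C v' u' × IsOdd M)))
lemma10p3 i j _ G (_ , crit) v u leaf C uncolorable =
  Leaf.both-matchings G crit C uncolorable leaf ,
  MinimumDegree.min-degree G crit C uncolorable ,
  λ v' u' flag → let open Leaf G crit C uncolorable (flag⇒leaf {G} {v'} {u'} flag)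
                 in even-matching , odd-matching
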